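{- Let $m\ge 1$, let $\sigma=(1,2,\dots,m)\in\mathbb{S}_m$ be the standard long cycle, and let $V_m$ be the complex vector space with basis the set $\mathbb{S}_m$. Then for every $\alpha\in\mathbb{S}_m$ and every $k\in\mathbb{Z}$, the basis vectors $\alpha$ and $\sigma^{ -k}\alpha\sigma^{k}$ are congruent modulo the subspace of $V_m$ spanned by all one-hyper-arc elements and all two-hyper-arc elements. (In other words, any two hyper arc diagrams representing the same hyper chord diagram are equivalent modulo generalized Vassiliev relations.)
   Context: A hyper arc diagram with $m$ legs is a permutation $\alpha\in\mathbb{S}_m$, visualized as the points $1,\dots,m$ placed in increasing order on an oriented line; the cycles of $\alpha$ are called hyper arcs (hyper edges) and the elements of a cycle are its legs. A hyper chord diagram is an equivalence class of hyper arc diagrams under $\alpha\sim\sigma^{ -k}\alpha\sigma^{k}$, $k\in\mathbb{Z}$, where $\sigma=(1,2,\dots,m)$. Moving a leg: for $\alpha\in\mathbb{S}_m$ and distinct $p,q\in\{1,\dots,m\}$, let $\alpha^{p\to q^- }$ (resp. $\alpha^{p\to q^+}$) be the permutation obtained as follows: remove $p$ from the linear order $1<2<\dots<m$ and reinsert it immediately before (resp. immediately after) $q$; let $\varphi$ be the bijection from $\{1,\dots,m\}$ to itself sending each element to its position in the new linear order; set $\alpha^{p\to q^\pm}=\varphi\alpha\varphi^{ -1}$. (Thus the cycle structure, including the position of $p$ inside its cycle, is kept, and only the position of $p$ on the line changes.) One-hyper-arc element: choose $\alpha\in\mathbb{S}_m$, a cycle $c$ of $\alpha$ and a leg $p\in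 c$ (the free leg); the element is $\sum_{q\in c,\,q\neq p}\big(\alpha^{p\to q^- }-\alpha^{p\to q^+}\big)\in V_m$. Two-hyper-arc element: choose $\alpha\in\mathbb{S}_m$, a leg $p$ (the free leg) of some cycle of $\alpha$, and a different cycle $c'$ of $\alpha$; the element is $\sum_{q\in c'}\big(\alpha^{p\to q^- }-\alpha^{p\to q^+}\big)\in V_m$. Setting these elements equal to zero are the generalized Vassiliev relations. -}

module Defs where

open import Level using (_⊔_)
open import Data.Nat using (ℕ; zero; suc)
open import Data.Integer using (ℤ; +_; -[1+_])
open import Data.Fin using (Fin; zero; suc; fromℕ; inject₁; punchOut; punchIn; _≟_)
open import Data.Fin.Permutation using (Permutation′; _⟨$⟩ʳ_; _∘ₚ_; flip; id; insert)
open import Data.Fin.Properties using (all?)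
open import Data.List using (List; []; _∷_; _++_; map; concatMap; foldr; upTo; allFin)
open import Data.Product using (_×_; _,_; Σ; ∃)
open import Relation.Binary.PropositionalEquality using (_≡_; _≢_)
open import Relation.Nullary using (¬_; Dec; yes; no)
open import Data.Empty using (⊥)
open import Data.Sum using (_⊎_; inj₁; inj₂)
open import Algebra.Bundles using (CommutativeRing)

-- Permutations.  The legs 1,…,m are represented by Fin m = {0,…,m-1}
-- (leg i+1 of the paper is  i : Fin m).  We always take m = suc n ≥ 1.

Perm : ℕ → Set
Perm m = Permutation′ m

-- Composition as functions:  (π · ρ)(x) = π (ρ x).
-- (stdlib's  _∘ₚ_  is diagrammatic:  (ρ ∘ₚ π) ⟨$⟩ʳ x = π ⟨$⟩ʳ (ρ ⟨$⟩ʳ x).)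
_·_ : ∀ {m} → Perm m → Perm m → Perm m
π · ρ = ρ ∘ₚ π

_⁻¹ : ∀ {m} → Perm m → Perm m
π ⁻¹ = flip π

_^ᴺ_ : ∀ {m} → Perm m → ℕ → Perm m
π ^ᴺ zero  = id
π ^ᴺ suc j = π · (π ^ᴺ j)

_^ᶻ_ : ∀ {m} → Perm m → ℤ → Perm m
π ^ᶻ (+ j)     = π ^ᴺ j
π ^ᶻ -[1+ j ]  = (π ⁻¹) ^ᴺ suc j

-- The standard long cycle σ = (1,2,…,m):  σ(i) = i+1 for i < last,
-- σ(last) = first.  Realised as  insert last zero id : last ↦ 0 and
-- x ↦ punchIn 0 (punchOut last x) = x+1 for x ≠ last.
σ : (n : ℕ) → Perm (suc n)
σ n = insert (fromℕ n) zero id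

-- Moving a leg.
-- φ(p,t) = insert p t id : the bijection obtained by removing p from the
-- linear order and reinserting it so that it lands at position t:
-- p ↦ t, and x ≠ p ↦ punchIn t (punchOut p x), i.e. x goes to its
-- position in the new linear order.

φ : ∀ {n} → Fin (suc n) → Fin (suc n) → Perm (suc n)
φ p t = insert p t id

moveTo : ∀ {n} → Perm (suc n) → (p t : Fin (suc n)) → Perm (suc n)
moveTo α p t = φ p t · (α · (φ p t ⁻¹))

-- α^{p→q^-}: p reinserted immediately before q.  In the order with p
-- removed, q sits at position  punchOut p≢q ; p takes that position.
move⁻ : ∀ {n} → Perm (suc n) → (p q : Fin (suc n)) → p ≢ q → Perm (suc n)
move⁻ α p q p≢q = moveTo α p (inject₁ (punchOut p≢q))

-- α^{p→q^+}: p reinserted immediately after q (position one larger).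
move⁺ : ∀ {n} → Perm (suc n) → (p q : Fin (suc n)) → p ≢ q → Perm (suc n)
move⁺ α p q p≢q = moveTo α p (suc (punchOut p≢q))

-- Cycles.  q lies in the cycle of α containing p iff q = αʲ(p) for some
-- j; since orbits have at most m elements it suffices to take j < m
-- (this makes membership decidable).

orbit : ∀ {m} → Perm m → Fin m → List (Fin m)
orbit {m} α p = map (λ j → (α ^ᴺ j) ⟨$⟩ʳ p) (upTo m)

inList : ∀ {m} → Fin m → List (Fin m) → Set
inList q []       = ⊥
inList q (x ∷ xs) = (q ≡ x) ⊎ inList q xs

inList? : ∀ {m} (q : Fin m) (xs : List (Fin m)) → Dec (inList q xs)
inList? q []       = no (λ ())
inList? q (x ∷ xs) with q ≟ x | inList? q xs
... | yes e | _     = yes (inj₁ e)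
... | no _  | yes i = yes (inj₂ i)
... | no ¬e | no ¬i = no λ { (inj₁ e) → ¬e e ; (inj₂ i) → ¬i i }

-- SameCycle α p q : q is a leg of the cycle (hyper arc) of α containing p
SameCycle : ∀ {m} → Perm m → Fin m → Fin m → Set
SameCycle α p q = inList q (orbit α p)

_≈ₚ_ : ∀ {m} → Perm m → Perm m → Set
π ≈ₚ ρ = ∀ i → π ⟨$⟩ʳ i ≡ ρ ⟨$⟩ʳ i

_≈ₚ?_ : ∀ {m} (π ρ : Perm m) → Dec (π ≈ₚ ρ)
π ≈ₚ? ρ = all? (λ i → π ⟨$⟩ʳ i ≟ ρ ⟨$⟩ʳ i)

-- The free module V_m over a commutative ring R with basis S_m
-- (the paper uses R = ℂ).  Elements are formal finite R-linear
-- combinations of permutations; two of them are equal in V_m iff all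
-- their coefficients agree.

module Vassiliev {c ℓ} (R : CommutativeRing c ℓ) where
  open CommutativeRing R renaming (Carrier to K)

  V : ℕ → Set c
  V m = List (K × Perm m)

  coeff : ∀ {m} → V m → Perm m → K
  coeff []             β = 0#
  coeff ((r , π) ∷ v)  β with π ≈ₚ? β
  ... | yes _ = r + coeff v β
  ... | no  _ = coeff v β

  _≈V_ : ∀ {m} → V m → V m → Set ℓ
  v ≈V w = ∀ β → coeff v β ≈ coeff w β

  basis : ∀ {m} → Perm m → V m
  basis π = (1# , π) ∷ []

  scale : ∀ {m} → K → V m → V m
  scale r = map (λ { (s , π) → (r * s , π) })

  _−V_ : ∀ {m} → V m → V m → V m
  v −V w = v ++ scale (- 1#) w

  -- the term  α^{p→q^-} − α^{p→q^+}  (zero vector if q = p, never used)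
  term : ∀ {n} → Perm (suc n) → (p q : Fin (suc n)) → V (suc n)
  term α p q with p ≟ q
  ... | yes _   = []
  ... | no p≢q  = basis (move⁻ α p q p≢q) −V basis (move⁺ α p q p≢q)

  sumOverCycle : ∀ {n} → Perm (suc n) → (p r : Fin (suc n)) → V (suc n)
  sumOverCycle α p r =
    concatMap (λ q → if⌊ inList? q (orbit α r) ⌋ (term α p q)) (allFin _)
    where
    if⌊_⌋ : ∀ {A : Set} → Dec A → V _ → V _
    if⌊ yes _ ⌋ v = v
    if⌊ no  _ ⌋ v = []

  -- One-hyper-arc element: cycle c = cycle of α through the free leg p;
  -- Σ_{q ∈ c, q ≠ p} (α^{p→q^-} − α^{p→q^+})   (term α p p = 0).
  oneArc : ∀ {n} → Perm (suc n) → Fin (suc n) → V (suc n)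
  oneArc α p = sumOverCycle α p p

  -- Two-hyper-arc element: free leg p, other cycle c' = cycle through r
  -- (r not in the cycle of p);  Σ_{q ∈ c'} (α^{p→q^-} − α^{p→q^+}).
  twoArc : ∀ {n} → Perm (suc n) → Fin (suc n) → Fin (suc n) → V (suc n)
  twoArc α p r = sumOverCycle α p r

  data Generator (n : ℕ) : Set where
    one : (α : Perm (suc n)) (p : Fin (suc n)) → Generator n
    two : (α : Perm (suc n)) (p r : Fin (suc n)) →
          ¬ SameCycle α p r → Generator n

  genVec : ∀ {n} → Generator n → V (suc n)
  genVec (one α p)     = oneArc α p
  genVec (two α p r _) = twoArc α p r

  combination : ∀ {n} → List (K × Generator n) → V (suc n)
  combination []             = []
  combination ((r , g) ∷ gs) = scale r (genVec g) ++ combination gs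

  InRelSpan : ∀ {n} → V (suc n) → Set (c ⊔ ℓ)
  InRelSpan {n} v = Σ (List (K × Generator n)) λ gs → v ≈V combination gs

  Congruent : ∀ {n} → V (suc n) → V (suc n) → Set (c ⊔ ℓ)
  Congruent v w = InRelSpan (v −V w)

-- Conjugating by σ moves the first leg from the front of the line to the back, so by induction
-- on |k| (and symmetry for negative k) it suffices to show that every γ is congruent to σ⁻¹γσ.
-- Number the legs 0, …, m−1 and take leg 0 as the free leg. For q = j+1 the term
-- γ^{0→q⁻} − γ^{0→q⁺} is the difference of γ with leg 0 moved to positions j and j+1, so the sum
-- of these terms over all legs telescopes to γ − σ⁻¹γσ. Grouping the legs q by their cycles, the
-- same sum is the one-hyper-arc element of the cycle of leg 0 plus one two-hyper-arc element for
-- every other cycle, each cycle counted once through its least leg.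
module Submission where

open import Algebra.Bundles using (AbelianGroup; CommutativeRing)
open import Data.Empty using (⊥-elim)
open import Data.Fin
  using (Fin; Fin′; zero; suc; toℕ; inject; inject₁; fromℕ; punchIn; _≟_; compare; less; equal; greater)
import Data.Fin.Properties as Finₚ
open import Data.Fin.Permutation as Permutation using (_⟨$⟩ʳ_; _⟨$⟩ˡ_)
open import Data.List using (List; []; _∷_; _++_; map; concatMap; tabulate; allFin)
open import Data.List.Membership.Propositional using (_∈_)
open import Data.List.Membership.Propositional.Properties using (∈-map⁺; ∈-map⁻; ∈-upTo⁺)
open import Data.List.Properties using (++-assoc)
open import Data.List.Relation.Unary.Any using (here; there)
open import Data.Nat using (ℕ; zero; suc)
open import Data.Product using (Σ-syntax; ∃-syntax; _×_; _,_; proj₁; proj₂; map₁)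
open import Data.Sum using (inj₁; inj₂)
open import Function using (_∘_; _$_; id)
open import Level using (_⊔_)
open import Relation.Binary.PropositionalEquality as ≡ using (_≡_; refl; cong; subst)
open import Relation.Nullary using (¬_; Dec; yes; no; ¬?)
open import Relation.Nullary.Decidable using (_×-dec_; decidable-stable)

open import Defs

-- Cycles of a permutation

inList⇒∈ : ∀ {m} {q : Fin m} xs → inList q xs → q ∈ xs
inList⇒∈ (x ∷ xs) (inj₁ q≡x)  = here q≡x
inList⇒∈ (x ∷ xs) (inj₂ q∈xs) = there (inList⇒∈ xs q∈xs)

∈⇒inList : ∀ {m} {q : Fin m} {xs} → q ∈ xs → inList q xs
∈⇒inList (here q≡x)   = inj₁ q≡x
∈⇒inList (there q∈xs) = inj₂ (∈⇒inList q∈xs)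

module _ {m} (α : Perm m) where
  open import Data.Nat using (_+_; _*_; _∸_; _<_)
  import Data.Nat.Properties as ℕₚ
  open import Data.Nat.DivMod using (_%_; _/_; m≡m%n+[m/n]*n; m%n<n)
  open ≡.≡-Reasoning

  power-+ : ∀ i j x → (α ^ᴺ (i + j)) ⟨$⟩ʳ x ≡ (α ^ᴺ i) ⟨$⟩ʳ ((α ^ᴺ j) ⟨$⟩ʳ x)
  power-+ zero    j x = refl
  power-+ (suc i) j x = cong (α ⟨$⟩ʳ_) (power-+ i j x)

  power-comm : ∀ j x → (α ^ᴺ j) ⟨$⟩ʳ (α ⟨$⟩ʳ x) ≡ α ⟨$⟩ʳ ((α ^ᴺ j) ⟨$⟩ʳ x)
  power-comm j x = ≡.trans (≡.sym (power-+ j 1 x)) (cong (λ i → (α ^ᴺ i) ⟨$⟩ʳ x) (ℕₚ.+-comm j 1))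

  power-injective : ∀ j {x y} → (α ^ᴺ j) ⟨$⟩ʳ x ≡ (α ^ᴺ j) ⟨$⟩ʳ y → x ≡ y
  power-injective zero    eq = eq
  power-injective (suc j) eq = power-injective j $
    ≡.trans (≡.sym (Permutation.inverseˡ α)) (≡.trans (cong (α ⟨$⟩ˡ_) eq) (Permutation.inverseˡ α))

  power-periodic : ∀ d {x} → (α ^ᴺ d) ⟨$⟩ʳ x ≡ x → ∀ k → (α ^ᴺ (k * d)) ⟨$⟩ʳ x ≡ x
  power-periodic d     αᵈx≡x zero    = refl
  power-periodic d {x} αᵈx≡x (suc k) = begin
    (α ^ᴺ (d + k * d)) ⟨$⟩ʳ x              ≡⟨ power-+ d (k * d) x ⟩
    (α ^ᴺ d) ⟨$⟩ʳ ((α ^ᴺ (k * d)) ⟨$⟩ʳ x) ≡⟨ cong ((α ^ᴺ d) ⟨$⟩ʳ_) (power-periodic d αᵈx≡x k) ⟩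
    (α ^ᴺ d) ⟨$⟩ʳ x                        ≡⟨ αᵈx≡x ⟩
    x                                      ∎

  -- Pigeonhole on x, α x, …, αᵐ x.
  recurrence : ∀ x → ∃[ d ] d < m × (α ^ᴺ suc d) ⟨$⟩ʳ x ≡ x
  recurrence x with Finₚ.pigeonhole (ℕₚ.n<1+n m) (λ (i : Fin (suc m)) → (α ^ᴺ toℕ i) ⟨$⟩ʳ x)
  ... | i , j , i<j , αⁱx≡αʲx = d , d<m , ≡.sym (power-injective (toℕ i) (begin
      (α ^ᴺ toℕ i) ⟨$⟩ʳ x                       ≡⟨ αⁱx≡αʲx ⟩
      (α ^ᴺ toℕ j) ⟨$⟩ʳ x                       ≡⟨ cong (λ k → (α ^ᴺ k) ⟨$⟩ʳ x) j≡i+[1+d] ⟩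
      (α ^ᴺ (toℕ i + suc d)) ⟨$⟩ʳ x             ≡⟨ power-+ (toℕ i) (suc d) x ⟩
      (α ^ᴺ toℕ i) ⟨$⟩ʳ ((α ^ᴺ suc d) ⟨$⟩ʳ x) ∎))
    where
    d : ℕ
    d = toℕ j ∸ suc (toℕ i)
    j≡i+[1+d] : toℕ j ≡ toℕ i + suc d
    j≡i+[1+d] = ≡.trans (≡.sym (ℕₚ.m+[n∸m]≡n (ℕₚ.<⇒≤ i<j))) (cong (toℕ i +_) (ℕₚ.+-∸-assoc 1 i<j))
    d<m : d < m
    d<m = ℕₚ.≤-trans (ℕₚ.≤-reflexive (≡.sym (ℕₚ.+-∸-assoc 1 i<j)))
                     (ℕₚ.≤-trans (ℕₚ.m∸n≤m (toℕ j) (toℕ i)) (ℕₚ.≤-pred (Finₚ.toℕ<n j)))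

  power-reduce : ∀ x j → ∃[ j′ ] j′ < m × (α ^ᴺ j′) ⟨$⟩ʳ x ≡ (α ^ᴺ j) ⟨$⟩ʳ x
  power-reduce x j with recurrence x
  ... | d , d<m , αᵈ⁺¹x≡x = j % suc d , ℕₚ.<-≤-trans (m%n<n j (suc d)) d<m , ≡.sym (begin
      (α ^ᴺ j) ⟨$⟩ʳ x
        ≡⟨ cong (λ k → (α ^ᴺ k) ⟨$⟩ʳ x) (m≡m%n+[m/n]*n j (suc d)) ⟩
      (α ^ᴺ (j % suc d + j / suc d * suc d)) ⟨$⟩ʳ x
        ≡⟨ power-+ (j % suc d) (j / suc d * suc d) x ⟩
      (α ^ᴺ (j % suc d)) ⟨$⟩ʳ ((α ^ᴺ (j / suc d * suc d)) ⟨$⟩ʳ x)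
        ≡⟨ cong ((α ^ᴺ (j % suc d)) ⟨$⟩ʳ_) (power-periodic (suc d) αᵈ⁺¹x≡x (j / suc d)) ⟩
      (α ^ᴺ (j % suc d)) ⟨$⟩ʳ x
        ∎)

  sameCycle? : ∀ p q → Dec (SameCycle α p q)
  sameCycle? p q = inList? q (orbit α p)

  sameCycle⇒power : ∀ {p q} → SameCycle α p q → ∃[ j ] q ≡ (α ^ᴺ j) ⟨$⟩ʳ p
  sameCycle⇒power {p} p~q with ∈-map⁻ (λ j → (α ^ᴺ j) ⟨$⟩ʳ p) (inList⇒∈ (orbit α p) p~q)
  ... | j , _ , q≡αʲp = j , q≡αʲp

  power⇒sameCycle : ∀ p j → SameCycle α p ((α ^ᴺ j) ⟨$⟩ʳ p)
  power⇒sameCycle p j with power-reduce p j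
  ... | j′ , j′<m , αʲ′p≡αʲp =
    ∈⇒inList (subst (_∈ orbit α p) αʲ′p≡αʲp (∈-map⁺ (λ j → (α ^ᴺ j) ⟨$⟩ʳ p) (∈-upTo⁺ j′<m)))

  sameCycle-refl : ∀ p → SameCycle α p p
  sameCycle-refl p = power⇒sameCycle p 0

  sameCycle-trans : ∀ {p q r} → SameCycle α p q → SameCycle α q r → SameCycle α p r
  sameCycle-trans {p} p~q q~r with sameCycle⇒power p~q | sameCycle⇒power q~r
  ... | i , refl | j , refl = subst (SameCycle α p) (power-+ j i p) (power⇒sameCycle p (j + i))

  sameCycle-sym : ∀ {p q} → SameCycle α p q → SameCycle α q p
  sameCycle-sym {p} p~q with sameCycle⇒power p~q | recurrence p
  ... | j , refl | d , _ , αᵈ⁺¹p≡p = subst (SameCycle α _) αʲᵈq≡p (power⇒sameCycle _ (j * d))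
    where
    αʲᵈq≡p : (α ^ᴺ (j * d)) ⟨$⟩ʳ ((α ^ᴺ j) ⟨$⟩ʳ p) ≡ p
    αʲᵈq≡p = begin
      (α ^ᴺ (j * d)) ⟨$⟩ʳ ((α ^ᴺ j) ⟨$⟩ʳ p) ≡⟨ power-+ (j * d) j p ⟨
      (α ^ᴺ (j * d + j)) ⟨$⟩ʳ p              ≡⟨ cong (λ k → (α ^ᴺ k) ⟨$⟩ʳ p) (ℕₚ.+-comm (j * d) j) ⟩
      (α ^ᴺ (j + j * d)) ⟨$⟩ʳ p              ≡⟨ cong (λ k → (α ^ᴺ k) ⟨$⟩ʳ p) (ℕₚ.*-suc j d) ⟨
      (α ^ᴺ (j * suc d)) ⟨$⟩ʳ p              ≡⟨ power-periodic (suc d) αᵈ⁺¹p≡p j ⟩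
      p                                      ∎

  IsCycleMinimum : Fin m → Set
  IsCycleMinimum r = (i : Fin′ r) → ¬ SameCycle α (inject i) r

  isCycleMinimum? : ∀ r → Dec (IsCycleMinimum r)
  isCycleMinimum? r = Finₚ.all? (λ i → ¬? (sameCycle? (inject i) r))

  cycleMinimum : ∀ q → ∃[ r ] IsCycleMinimum r × SameCycle α r q
  cycleMinimum q with Finₚ.¬∀⟶∃¬-smallest m (λ r → ¬ SameCycle α r q) (λ r → ¬? (sameCycle? r q))
                                            (λ none → none q (sameCycle-refl q))
  ... | r , ¬¬r~q , below-r≁q = r , (λ i i~r → below-r≁q i (sameCycle-trans i~r r~q)) , r~q
    where
    r~q : SameCycle α r q
    r~q = decidable-stable (sameCycle? r q) ¬¬r~q

  cycleMinimum-unique : ∀ {r s q} → IsCycleMinimum r → IsCycleMinimum s →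
                        SameCycle α r q → SameCycle α s q → r ≡ s
  cycleMinimum-unique {r} {s} min-r min-s r~q s~q with compare r s
  ... | less    s i = ⊥-elim (min-s i (sameCycle-trans r~q (sameCycle-sym s~q)))
  ... | equal   r   = refl
  ... | greater r i = ⊥-elim (min-r i (sameCycle-trans s~q (sameCycle-sym r~q)))

sandwich-cong : ∀ {m} {π π′ ρ ρ′ : Perm m} (γ : Perm m) →
                π ≈ₚ π′ → ρ ≈ₚ ρ′ → (π · (γ · ρ)) ≈ₚ (π′ · (γ · ρ′))
sandwich-cong {π′ = π′} {ρ = ρ} γ π≈π′ ρ≈ρ′ x =
  ≡.trans (π≈π′ (γ ⟨$⟩ʳ (ρ ⟨$⟩ʳ x))) (cong (λ y → π′ ⟨$⟩ʳ (γ ⟨$⟩ʳ y)) (ρ≈ρ′ x))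

module _ {m} (π ρ : Perm m) (πρ≈id : ∀ x → π ⟨$⟩ʳ (ρ ⟨$⟩ʳ x) ≡ x) where

  left-inverse⇒≈⁻¹ : π ≈ₚ (ρ ⁻¹)
  left-inverse⇒≈⁻¹ y = ≡.trans (cong (π ⟨$⟩ʳ_) (≡.sym (Permutation.inverseʳ ρ))) (πρ≈id (ρ ⟨$⟩ˡ y))

  left-inverse⇒⁻¹≈ : (π ⁻¹) ≈ₚ ρ
  left-inverse⇒⁻¹≈ x = ≡.trans (cong (π ⟨$⟩ˡ_) (≡.sym (πρ≈id x))) (Permutation.inverseˡ π)

moveTo-zero-zero : ∀ {n} (γ : Perm (suc n)) → moveTo γ zero zero ≈ₚ γ
moveTo-zero-zero γ = sandwich-cong {π = φ zero zero} {Permutation.id} {φ zero zero ⁻¹} {Permutation.id} γ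
                                   φ₀₀≈id (left-inverse⇒⁻¹≈ (φ zero zero) Permutation.id φ₀₀≈id)
  where
  φ₀₀≈id : ∀ x → φ zero zero ⟨$⟩ʳ (Permutation.id ⟨$⟩ʳ x) ≡ x
  φ₀₀≈id zero    = refl
  φ₀₀≈id (suc x) = refl

-- Reinserting the first leg after the last one rotates the line backwards: φ(0, m−1) = σ⁻¹.
moveTo-zero-last : ∀ {n} (γ : Perm (suc n)) → moveTo γ zero (fromℕ n) ≈ₚ ((σ n ⁻¹) · (γ · σ n))
moveTo-zero-last {n} γ = sandwich-cong {π = φ₀ₙ} {σ n ⁻¹} {φ₀ₙ ⁻¹} {σ n} γ
                                       (left-inverse⇒≈⁻¹ φ₀ₙ (σ n) φσ≈id) (left-inverse⇒⁻¹≈ φ₀ₙ (σ n) φσ≈id)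
  where
  φ₀ₙ : Perm (suc n)
  φ₀ₙ = φ zero (fromℕ n)

  φσ≈id : ∀ x → φ₀ₙ ⟨$⟩ʳ (σ n ⟨$⟩ʳ x) ≡ x
  φσ≈id x with fromℕ n ≟ x
  ... | yes last≡x = last≡x
  ... | no  last≢x = Finₚ.punchIn-punchOut last≢x

-- Finite sums

module _ {a ℓ} (G : AbelianGroup a ℓ) where
  open AbelianGroup G renaming (_∙_ to _+_; _⁻¹ to -_; ε to 0#)
  open import Algebra.Properties.CommutativeMonoid.Sum commutativeMonoid using (sum-syntax)
  open import Relation.Binary.Reasoning.Setoid setoid

  +-telescope : ∀ x y z → (x + - y) + (y + - z) ≈ x + - z
  +-telescope x y z = begin
    (x + - y) + (y + - z) ≈⟨ assoc x (- y) (y + - z) ⟩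
    x + (- y + (y + - z)) ≈⟨ ∙-congˡ (assoc (- y) y (- z)) ⟨
    x + ((- y + y) + - z) ≈⟨ ∙-congˡ (∙-congʳ (inverseˡ y)) ⟩
    x + (0# + - z)        ≈⟨ ∙-congˡ (identityˡ (- z)) ⟩
    x + - z               ∎

  sum-telescope : ∀ n (f : Fin (suc n) → Carrier) →
                  ∑[ j < n ] (f (inject₁ j) + - f (suc j)) ≈ f zero + - f (fromℕ n)
  sum-telescope zero    f = sym (inverseʳ (f zero))
  sum-telescope (suc n) f = trans (∙-congˡ (sum-telescope n (f ∘ suc))) (+-telescope _ _ _)

module _ {c ℓ} (R : CommutativeRing c ℓ) where
  open CommutativeRing R renaming (Carrier to K; refl to ≈-refl) hiding (zero)
  open Vassiliev R
  open import Algebra.Properties.Semiring.Sum semiring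
    using (sum-syntax; sum-cong-≋; sum-replicate-zero; sum-remove; ∑-comm; *-distribˡ-sum; *-distribʳ-sum)
  open import Algebra.Properties.Ring ring using (-1*x≈-x)
  open import Algebra.Properties.AbelianGroup +-abelianGroup using (⁻¹-anti-homo‿-)
  open import Relation.Binary.Reasoning.Setoid setoid

  𝟙[_] : ∀ {A : Set} → Dec A → K
  𝟙[ yes _ ] = 1#
  𝟙[ no  _ ] = 0#

  𝟙-yes : ∀ {A : Set} (a? : Dec A) → A → 𝟙[ a? ] ≈ 1#
  𝟙-yes (yes _) _ = ≈-refl
  𝟙-yes (no ¬a) a = ⊥-elim (¬a a)

  𝟙-no : ∀ {A : Set} (a? : Dec A) → ¬ A → 𝟙[ a? ] ≈ 0#
  𝟙-no (yes a) ¬a = ⊥-elim (¬a a)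
  𝟙-no (no _)  _  = ≈-refl

  𝟙-cong : ∀ {A B : Set} (a? : Dec A) (b? : Dec B) → (A → B) → (B → A) → 𝟙[ a? ] ≈ 𝟙[ b? ]
  𝟙-cong a? (yes b) _   B→A = 𝟙-yes a? (B→A b)
  𝟙-cong a? (no ¬b) A→B _   = 𝟙-no a? (¬b ∘ A→B)

  𝟙-× : ∀ {A B : Set} (a? : Dec A) (b? : Dec B) → 𝟙[ a? ×-dec b? ] ≈ 𝟙[ a? ] * 𝟙[ b? ]
  𝟙-× (yes _) (yes _) = sym (*-identityˡ 1#)
  𝟙-× (yes _) (no _)  = sym (zeroʳ 1#)
  𝟙-× (no _)  _       = sym (zeroˡ _)

  sum-zero : ∀ n {f : Fin n → K} → (∀ i → f i ≈ 0#) → ∑[ i < n ] f i ≈ 0#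
  sum-zero n f≈0 = trans (sum-cong-≋ f≈0) (sum-replicate-zero n)

  sum-𝟙-unique : ∀ {n} {P : Fin n → Set} (P? : ∀ i → Dec (P i)) {i} → P i → (∀ {j} → P j → j ≡ i) →
                 ∑[ j < n ] 𝟙[ P? j ] ≈ 1#
  sum-𝟙-unique {suc n} P? {i} Pi unique = begin
    ∑[ j < suc n ] 𝟙[ P? j ]                      ≈⟨ sum-remove {i = i} (λ j → 𝟙[ P? j ]) ⟩
    𝟙[ P? i ] + ∑[ j < n ] 𝟙[ P? (punchIn i j) ] ≈⟨ +-cong (𝟙-yes (P? i) Pi) (sum-zero n λ j →
                                                      𝟙-no (P? (punchIn i j)) (Finₚ.punchInᵢ≢i i j ∘ unique)) ⟩
    1# + 0#                                       ≈⟨ +-identityʳ 1# ⟩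
    1#                                            ∎

  sum-partitionOfUnity : ∀ {m} (w : Fin m → K) (a : Fin m → Fin m → K) (t : Fin m → K) →
                         (∀ q → ∑[ r < m ] (w r * a r q) ≈ 1#) →
                         ∑[ r < m ] (w r * ∑[ q < m ] (a r q * t q)) ≈ ∑[ q < m ] t q
  sum-partitionOfUnity {m} w a t unity = begin
    ∑[ r < m ] (w r * ∑[ q < m ] (a r q * t q))
      ≈⟨ sum-cong-≋ (λ r → *-distribˡ-sum (w r) (λ q → a r q * t q)) ⟩
    ∑[ r < m ] ∑[ q < m ] (w r * (a r q * t q))
      ≈⟨ ∑-comm (λ r q → w r * (a r q * t q)) ⟩
    ∑[ q < m ] ∑[ r < m ] (w r * (a r q * t q))
      ≈⟨ sum-cong-≋ (λ q → sum-cong-≋ λ r → *-assoc (w r) (a r q) (t q)) ⟨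
    ∑[ q < m ] ∑[ r < m ] (w r * a r q * t q)
      ≈⟨ sum-cong-≋ (λ q → *-distribʳ-sum (t q) (λ r → w r * a r q)) ⟨
    ∑[ q < m ] (∑[ r < m ] (w r * a r q) * t q)
      ≈⟨ sum-cong-≋ (λ q → trans (*-congʳ (unity q)) (*-identityˡ (t q))) ⟩
    ∑[ q < m ] t q
      ∎

  coeff-++ : ∀ {m} (v w : V m) β → coeff (v ++ w) β ≈ coeff v β + coeff w β
  coeff-++ []            w β = sym (+-identityˡ _)
  coeff-++ ((r , π) ∷ v) w β with π ≈ₚ? β
  ... | yes _ = trans (+-congˡ (coeff-++ v w β)) (sym (+-assoc r _ _))
  ... | no  _ = coeff-++ v w β

  coeff-scale : ∀ {m} r (v : V m) β → coeff (scale r v) β ≈ r * coeff v β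
  coeff-scale r []            β = sym (zeroʳ r)
  coeff-scale r ((s , π) ∷ v) β with π ≈ₚ? β
  ... | yes _ = trans (+-congˡ (coeff-scale r v β)) (sym (distribˡ r s _))
  ... | no  _ = coeff-scale r v β

  coeff-−V : ∀ {m} (v w : V m) β → coeff (v −V w) β ≈ coeff v β - coeff w β
  coeff-−V v w β = trans (coeff-++ v _ β) (+-congˡ (trans (coeff-scale (- 1#) w β) (-1*x≈-x _)))

  coeff-basis-cong : ∀ {m} {π ρ : Perm m} → π ≈ₚ ρ → ∀ β → coeff (basis π) β ≈ coeff (basis ρ) β
  coeff-basis-cong {π = π} {ρ} π≈ρ β with π ≈ₚ? β | ρ ≈ₚ? β
  ... | yes _   | yes _   = ≈-refl
  ... | no  _   | no  _   = ≈-refl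
  ... | yes π≈β | no  ρ≉β = ⊥-elim (ρ≉β λ i → ≡.trans (≡.sym (π≈ρ i)) (π≈β i))
  ... | no  π≉β | yes ρ≈β = ⊥-elim (π≉β λ i → ≡.trans (π≈ρ i) (ρ≈β i))

  coeff-concatMap-tabulate : ∀ {m k} {A : Set} (f : A → V m) (g : Fin k → A) β →
                             coeff (concatMap f (tabulate g)) β ≈ ∑[ i < k ] coeff (f (g i)) β
  coeff-concatMap-tabulate {k = zero}  f g β = ≈-refl
  coeff-concatMap-tabulate {k = suc k} f g β =
    trans (coeff-++ (f (g zero)) _ β) (+-congˡ (coeff-concatMap-tabulate f (g ∘ suc) β))

  combination-++ : ∀ {n} (gs hs : List (K × Generator n)) →
                   combination (gs ++ hs) ≡ combination gs ++ combination hs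
  combination-++ []             hs = refl
  combination-++ ((r , g) ∷ gs) hs =
    ≡.trans (cong (scale r (genVec g) ++_) (combination-++ gs hs)) (≡.sym (++-assoc (scale r (genVec g)) _ _))

  coeff-combination-scale : ∀ {n} r (gs : List (K × Generator n)) β →
                            coeff (combination (map (map₁ (r *_)) gs)) β ≈ r * coeff (combination gs) β
  coeff-combination-scale r []             β = sym (zeroʳ r)
  coeff-combination-scale r ((s , g) ∷ gs) β = begin
    coeff (scale (r * s) (genVec g) ++ combination (map (map₁ (r *_)) gs)) β
      ≈⟨ coeff-++ (scale (r * s) (genVec g)) _ β ⟩
    coeff (scale (r * s) (genVec g)) β + coeff (combination (map (map₁ (r *_)) gs)) β
      ≈⟨ +-cong (coeff-scale (r * s) (genVec g) β) (coeff-combination-scale r gs β) ⟩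
    r * s * coeff (genVec g) β + r * coeff (combination gs) β
      ≈⟨ +-congʳ (*-assoc r s _) ⟩
    r * (s * coeff (genVec g) β) + r * coeff (combination gs) β
      ≈⟨ distribˡ r _ _ ⟨
    r * (s * coeff (genVec g) β + coeff (combination gs) β)
      ≈⟨ *-congˡ (+-congʳ (coeff-scale s (genVec g) β)) ⟨
    r * (coeff (scale s (genVec g)) β + coeff (combination gs) β)
      ≈⟨ *-congˡ (coeff-++ (scale s (genVec g)) _ β) ⟨
    r * coeff (scale s (genVec g) ++ combination gs) β
      ∎

  coeff-combination-tabulate : ∀ {n k} (h : Fin k → K × Generator n) β →
    coeff (combination (tabulate h)) β ≈ ∑[ i < k ] (proj₁ (h i) * coeff (genVec (proj₂ (h i))) β)
  coeff-combination-tabulate {k = zero}  h β = ≈-refl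
  coeff-combination-tabulate {k = suc k} h β =
    trans (coeff-++ (scale r₀ (genVec g₀)) _ β)
          (+-cong (coeff-scale r₀ (genVec g₀) β) (coeff-combination-tabulate (h ∘ suc) β))
    where
    r₀ : K
    r₀ = proj₁ (h zero)
    g₀ : Generator _
    g₀ = proj₂ (h zero)

  -- The case distinction inside sumOverCycle is a helper local to its definition and cannot be
  -- named; unification recovers the summands as a function, and with-abstraction evaluates them.
  sumOverCycle-summands : ∀ {n} (α : Perm (suc n)) (p r : Fin (suc n)) →
    Σ[ f ∈ (Fin (suc n) → V (suc n)) ] sumOverCycle α p r ≡ concatMap f (allFin (suc n))
  sumOverCycle-summands α p r = _ , refl

  coeff-sumOverCycle-summand : ∀ {n} (α : Perm (suc n)) (p r q : Fin (suc n)) β →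
    coeff (proj₁ (sumOverCycle-summands α p r) q) β ≈ 𝟙[ sameCycle? α r q ] * coeff (term α p q) β
  coeff-sumOverCycle-summand α p r q β with sameCycle? α r q
  ... | yes _ = sym (*-identityˡ _)
  ... | no  _ = sym (zeroˡ _)

  coeff-sumOverCycle : ∀ {n} (α : Perm (suc n)) (p r : Fin (suc n)) β →
    coeff (sumOverCycle α p r) β ≈ ∑[ q < suc n ] (𝟙[ sameCycle? α r q ] * coeff (term α p q) β)
  coeff-sumOverCycle α p r β =
    trans (coeff-concatMap-tabulate (proj₁ (sumOverCycle-summands α p r)) id β)
          (sum-cong-≋ λ q → coeff-sumOverCycle-summand α p r q β)

  infix 4 _≋_
  record _≋_ {n} (π ρ : Perm (suc n)) : Set (c ⊔ ℓ) where
    constructor mk≋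
    field congruent : Congruent (basis π) (basis ρ)

  ≋-reflexive : ∀ {n} {π ρ : Perm (suc n)} → π ≈ₚ ρ → π ≋ ρ
  ≋-reflexive {π = π} {ρ} π≈ρ = mk≋ $ [] , λ β → begin
    coeff (basis π −V basis ρ) β          ≈⟨ coeff-−V (basis π) (basis ρ) β ⟩
    coeff (basis π) β - coeff (basis ρ) β ≈⟨ +-congʳ (coeff-basis-cong π≈ρ β) ⟩
    coeff (basis ρ) β - coeff (basis ρ) β ≈⟨ -‿inverseʳ _ ⟩
    0#                                    ∎

  ≋-trans : ∀ {n} {π ρ τ : Perm (suc n)} → π ≋ ρ → ρ ≋ τ → π ≋ τ
  ≋-trans {π = π} {ρ} {τ} (mk≋ (gs , π−ρ≈gs)) (mk≋ (hs , ρ−τ≈hs)) = mk≋ $ gs ++ hs , λ β → begin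
    coeff (basis π −V basis τ) β
      ≈⟨ coeff-−V (basis π) (basis τ) β ⟩
    coeff (basis π) β - coeff (basis τ) β
      ≈⟨ +-telescope +-abelianGroup _ _ _ ⟨
    (coeff (basis π) β - coeff (basis ρ) β) + (coeff (basis ρ) β - coeff (basis τ) β)
      ≈⟨ +-cong (coeff-−V (basis π) (basis ρ) β) (coeff-−V (basis ρ) (basis τ) β) ⟨
    coeff (basis π −V basis ρ) β + coeff (basis ρ −V basis τ) β
      ≈⟨ +-cong (π−ρ≈gs β) (ρ−τ≈hs β) ⟩
    coeff (combination gs) β + coeff (combination hs) β
      ≈⟨ coeff-++ (combination gs) (combination hs) β ⟨
    coeff (combination gs ++ combination hs) β
      ≡⟨ cong (λ v → coeff v β) (combination-++ gs hs) ⟨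
    coeff (combination (gs ++ hs)) β
      ∎

  ≋-sym : ∀ {n} {π ρ : Perm (suc n)} → π ≋ ρ → ρ ≋ π
  ≋-sym {π = π} {ρ} (mk≋ (gs , π−ρ≈gs)) = mk≋ $ map (map₁ (- 1# *_)) gs , λ β → begin
    coeff (basis ρ −V basis π) β                   ≈⟨ coeff-−V (basis ρ) (basis π) β ⟩
    coeff (basis ρ) β - coeff (basis π) β          ≈⟨ ⁻¹-anti-homo‿- (coeff (basis π) β) (coeff (basis ρ) β) ⟨
    - (coeff (basis π) β - coeff (basis ρ) β)      ≈⟨ -1*x≈-x _ ⟨
    - 1# * (coeff (basis π) β - coeff (basis ρ) β) ≈⟨ *-congˡ (coeff-−V (basis π) (basis ρ) β) ⟨
    - 1# * coeff (basis π −V basis ρ) β            ≈⟨ *-congˡ (π−ρ≈gs β) ⟩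
    - 1# * coeff (combination gs) β                ≈⟨ coeff-combination-scale (- 1#) gs β ⟨
    coeff (combination (map (map₁ (- 1# *_)) gs)) β ∎

  -- One conjugation by σ

  module _ {n} (γ : Perm (suc n)) where

    cycleRelation : Fin (suc n) → Generator n
    cycleRelation r with sameCycle? γ zero r
    ... | yes _   = one γ zero
    ... | no  0≁r = two γ zero r 0≁r

    coeff-cycleRelation : ∀ r β → coeff (genVec (cycleRelation r)) β ≈
                          ∑[ q < suc n ] (𝟙[ sameCycle? γ r q ] * coeff (term γ zero q) β)
    coeff-cycleRelation r β with sameCycle? γ zero r
    ... | no  _   = coeff-sumOverCycle γ zero r β
    ... | yes 0~r = trans (coeff-sumOverCycle γ zero zero β) (sum-cong-≋ same-cycle)
      where
      same-cycle : ∀ q → 𝟙[ sameCycle? γ zero q ] * coeff (term γ zero q) β ≈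
                         𝟙[ sameCycle? γ r q ] * coeff (term γ zero q) β
      same-cycle q = *-congʳ (𝟙-cong (sameCycle? γ zero q) (sameCycle? γ r q)
                                     (sameCycle-trans γ (sameCycle-sym γ 0~r)) (sameCycle-trans γ 0~r))

    weightedCycleRelation : Fin (suc n) → K × Generator n
    weightedCycleRelation r = 𝟙[ isCycleMinimum? γ r ] , cycleRelation r

    cycleMinimum-count : ∀ q → ∑[ r < suc n ] (𝟙[ isCycleMinimum? γ r ] * 𝟙[ sameCycle? γ r q ]) ≈ 1#
    cycleMinimum-count q with cycleMinimum γ q
    ... | r₀ , min-r₀ , r₀~q =
      trans (sum-cong-≋ λ r → sym (𝟙-× (isCycleMinimum? γ r) (sameCycle? γ r q)))
            (sum-𝟙-unique (λ r → isCycleMinimum? γ r ×-dec sameCycle? γ r q) (min-r₀ , r₀~q)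
                          (λ (min-r , r~q) → cycleMinimum-unique γ min-r min-r₀ r~q r₀~q))

    coeff-cycleRelations : ∀ β → coeff (combination (tabulate weightedCycleRelation)) β ≈
                                 ∑[ q < suc n ] coeff (term γ zero q) β
    coeff-cycleRelations β = trans (coeff-combination-tabulate weightedCycleRelation β)
      (trans (sum-cong-≋ λ r → *-congˡ {𝟙[ isCycleMinimum? γ r ]} (coeff-cycleRelation r β))
             (sum-partitionOfUnity (λ r → 𝟙[ isCycleMinimum? γ r ]) (λ r q → 𝟙[ sameCycle? γ r q ])
                                   (λ q → coeff (term γ zero q) β) cycleMinimum-count))

    -- The summand for q = 0 is empty and the one for q = j+1 moves leg 0 to positions j and j+1.
    sum-coeff-term : ∀ β → ∑[ q < suc n ] coeff (term γ zero q) β ≈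
                           coeff (basis (moveTo γ zero zero)) β - coeff (basis (moveTo γ zero (fromℕ n))) β
    sum-coeff-term β = begin
      0# + ∑[ j < n ] coeff (basis (moveTo γ zero (inject₁ j)) −V basis (moveTo γ zero (suc j))) β
        ≈⟨ +-identityˡ _ ⟩
      ∑[ j < n ] coeff (basis (moveTo γ zero (inject₁ j)) −V basis (moveTo γ zero (suc j))) β
        ≈⟨ sum-cong-≋ (λ j → coeff-−V (basis (moveTo γ zero (inject₁ j))) (basis (moveTo γ zero (suc j))) β) ⟩
      ∑[ j < n ] (b (inject₁ j) - b (suc j))
        ≈⟨ sum-telescope +-abelianGroup n b ⟩
      b zero - b (fromℕ n)
        ∎
      where
      b : Fin (suc n) → K
      b t = coeff (basis (moveTo γ zero t)) β

    moveTo-zero≋moveTo-last : moveTo γ zero zero ≋ moveTo γ zero (fromℕ n)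
    moveTo-zero≋moveTo-last = mk≋ $ tabulate weightedCycleRelation , λ β →
      trans (coeff-−V (basis (moveTo γ zero zero)) (basis (moveTo γ zero (fromℕ n))) β)
            (trans (sym (sum-coeff-term β)) (sym (coeff-cycleRelations β)))

  ≋-conjugate-σ : ∀ {n} (γ : Perm (suc n)) → γ ≋ ((σ n ⁻¹) · (γ · σ n))
  ≋-conjugate-σ γ = ≋-trans (≋-reflexive (λ x → ≡.sym (moveTo-zero-zero γ x)))
                            (≋-trans (moveTo-zero≋moveTo-last γ) (≋-reflexive (moveTo-zero-last γ)))

  module _ {n} (τ : Perm (suc n)) (≋-conjugate : ∀ γ → γ ≋ ((τ ⁻¹) · (γ · τ))) where

    ≋-conjugate-power : ∀ j α → α ≋ (((τ ⁻¹) ^ᴺ j) · (α · (τ ^ᴺ j)))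
    ≋-conjugate-power zero    α = ≋-reflexive λ _ → refl
    ≋-conjugate-power (suc j) α =
      ≋-trans (≋-conjugate-power j α) (≋-trans (≋-conjugate _) (≋-reflexive λ x →
        cong (λ y → (τ ⁻¹) ⟨$⟩ʳ (((τ ⁻¹) ^ᴺ j) ⟨$⟩ʳ (α ⟨$⟩ʳ y))) (power-comm τ j x)))

    ≋-conjugate⁻¹ : ∀ γ → γ ≋ (((τ ⁻¹) ⁻¹) · (γ · (τ ⁻¹)))
    ≋-conjugate⁻¹ γ = ≋-sym (≋-trans (≋-conjugate _) (≋-reflexive λ x →
      ≡.trans (Permutation.inverseˡ τ) (cong (γ ⟨$⟩ʳ_) (Permutation.inverseˡ τ))))

open import Data.Integer using (ℤ; +_; -[1+_]; -_)

mainTheorem1 : ∀ {c ℓ} (R : CommutativeRing c ℓ) (n : ℕ) (α : Perm (suc n)) (k : ℤ) →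
    Vassiliev.Congruent R (Vassiliev.basis R α)
      (Vassiliev.basis R (((σ n) ^ᶻ (- k)) · (α · ((σ n) ^ᶻ k))))
mainTheorem1 R n α (+ zero)   = _≋_.congruent (≋-conjugate-power R (σ n) (≋-conjugate-σ R) 0 α)
mainTheorem1 R n α (+ suc j)  = _≋_.congruent (≋-conjugate-power R (σ n) (≋-conjugate-σ R) (suc j) α)
mainTheorem1 R n α -[1+ j ]   =
  _≋_.congruent (≋-conjugate-power R (σ n ⁻¹) (≋-conjugate⁻¹ R (σ n) (≋-conjugate-σ R)) (suc j) α)
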